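{- Let $A\subseteq\mathbb{R}^n$ be generic and let $x,y\in A$ be distinct. If $x$ is an $A$-neighbor of $y$ (i.e. $\{x,y\}$ is $A$-neighborly), then $x$ is a weak $A$-neighbor of $y$.
   Context: For $x\in\mathbb{R}^n$, $\pi_i(x)$ is its $i$-th coordinate. Order: $x\le y$ iff $\pi_i(x)\le\pi_i(y)$ for all $i$; $x\ll y$ iff $\pi_i(x)<\pi_i(y)$ for all $i$; $\vee B$ is the coordinatewise supremum. $\mathbb{O}^n=[0,\infty)^n$, $\mathbb{O}^n_J=\{x\in\mathbb{O}^n:\pi_j(x)=0\ \forall j\in J\}$. Given $A\subseteq\mathbb{R}^n$, a nonempty $B\subseteq\mathbb{R}^n$ is $A$-neighborly if bounded above and there is no $a\in A$ with $a\ll\vee B$. $A$ is generic if for every nonempty $A$-neighborly $B\subseteq A$ and every nonempty $J\subseteq\{1,\dots,n\}$, the set $\{x\le\vee B:\pi_j(x)=\pi_j(\vee B)\ \forall j\in J\}$ contains at most one element of $A$. The rectangle from $x$ to $y$ is the set of $z\in\mathbb{R}^n$ such that for each $i$, $\pi_i(z)$ lies in the closed interval between $\pi_i(x)$ and $\pi_i(y)$. For $y\in\mathbb{R}^n$, $x\in A$ is a weak $A$-neighbor of $y$ if $x\ne y$ and no $z\in A$ other than $x$ and $y$ lies in the rectangle from $x$ to $y$. -}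

module Defs where

open import Level using (0ℓ)
open import Data.Nat using (ℕ)
open import Data.Fin using (Fin)
open import Data.Fin.Subset using (Subset; Nonempty; _∈_)
open import Data.Vec using (Vec; lookup)
open import Data.Product using (Σ; ∃; _×_; _,_)
open import Data.Sum using (_⊎_)
open import Relation.Nullary using (¬_)
open import Relation.Unary using (Pred; _⊆_)
open import Relation.Binary.PropositionalEquality using (_≡_; _≢_)
open import Relation.Binary.Structures using (IsStrictTotalOrder)
open import Algebra.Structures using (IsCommutativeRing)

record CompleteOrderedField : Set₁ where
  infixl 6 _+_
  infixl 7 _*_
  infix 4 _<_ _≤_
  field
    ℝ   : Set
    _+_ : ℝ → ℝ → ℝ
    _*_ : ℝ → ℝ → ℝ
    -_  : ℝ → ℝ
    0#  : ℝ
    1#  : ℝ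
    isCommutativeRing : IsCommutativeRing _≡_ _+_ _*_ -_ 0# 1#
    0≢1 : 0# ≢ 1#
    inverse : ∀ x → x ≢ 0# → ∃ λ y → x * y ≡ 1#
    _<_ : ℝ → ℝ → Set
    isStrictTotalOrder : IsStrictTotalOrder _≡_ _<_
    +-mono-< : ∀ {x y} z → x < y → x + z < y + z
    *-pos    : ∀ {x y} → 0# < x → 0# < y → 0# < x * y

  _≤_ : ℝ → ℝ → Set
  x ≤ y = x < y ⊎ x ≡ y

  IsLub : Pred ℝ 0ℓ → ℝ → Set
  IsLub P s = (∀ x → P x → x ≤ s) × (∀ u → (∀ x → P x → x ≤ u) → s ≤ u)

  field
    complete : (P : Pred ℝ 0ℓ) → (∃ λ x → P x) → (∃ λ b → ∀ x → P x → x ≤ b) →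
               ∃ λ s → IsLub P s

module Geometry (R : CompleteOrderedField) where
  open CompleteOrderedField R

  Point : ℕ → Set
  Point n = Vec ℝ n

  π : ∀ {n} → Fin n → Point n → ℝ
  π i x = lookup x i

  _≤ᵥ_ : ∀ {n} → Point n → Point n → Set
  x ≤ᵥ y = ∀ i → π i x ≤ π i y

  _≪_ : ∀ {n} → Point n → Point n → Set
  x ≪ y = ∀ i → π i x < π i y

  BoundedAbove : ∀ {n} → Pred (Point n) 0ℓ → Set
  BoundedAbove B = ∃ λ u → ∀ b → B b → b ≤ᵥ u

  IsSup : ∀ {n} → Pred (Point n) 0ℓ → Point n → Set
  IsSup B s = ∀ i → IsLub (λ r → ∃ λ b → B b × π i b ≡ r) (π i s)

  Neighborly : ∀ {n} → Pred (Point n) 0ℓ → Pred (Point n) 0ℓ → Set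
  Neighborly A B = (∃ λ b → B b) × BoundedAbove B ×
                   (∀ s → IsSup B s → ¬ (∃ λ a → A a × a ≪ s))

  InFace : ∀ {n} → Point n → Subset n → Point n → Set
  InFace s J x = x ≤ᵥ s × (∀ j → j ∈ J → π j x ≡ π j s)

  Generic : ∀ {n} → Pred (Point n) 0ℓ → Set₁
  Generic {n} A =
    ∀ (B : Pred (Point n) 0ℓ) → B ⊆ A → Neighborly A B →
    ∀ (J : Subset n) → Nonempty J →
    ∀ s → IsSup B s →
    ∀ a a' → A a → A a' → InFace s J a → InFace s J a' → a ≡ a'

  pair : ∀ {n} → Point n → Point n → Pred (Point n) 0ℓ
  pair x y z = z ≡ x ⊎ z ≡ y

  InRect : ∀ {n} → Point n → Point n → Point n → Set
  InRect x y z = ∀ i → (π i x ≤ π i z × π i z ≤ π i y) ⊎ (π i y ≤ π i z × π i z ≤ π i x)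

  WeakNeighbor : ∀ {n} → Pred (Point n) 0ℓ → Point n → Point n → Set
  WeakNeighbor A x y =
    A x × x ≢ y × (∀ z → A z → z ≢ x → z ≢ y → ¬ InRect x y z)

-- The supremum of {x, y} is the coordinatewise maximum s, and every point z of the
-- rectangle from x to y lies below s. Since no point of A lies strictly below s, z
-- agrees with s in some coordinate j; there s agrees with x or with y, so z and that
-- point lie on the face {π j = π j s} below s, and genericity forces them to be equal.
module Submission where

open import Defs
open import Data.Nat using (ℕ)
open import Data.Fin using (Fin)
open import Data.Fin.Properties using (any?)
open import Data.Fin.Subset using (⁅_⁆)
open import Data.Fin.Subset.Properties using (x∈⁅x⁆; x∈⁅y⁆⇒x≡y)
open import Data.Vec using (tabulate)
open import Data.Vec.Properties using (lookup∘tabulate)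
open import Data.Product using (∃; _×_; _,_)
open import Data.Sum using (_⊎_; inj₁; inj₂; [_,_]; map)
open import Relation.Nullary using (yes; no; contradiction)
open import Relation.Unary using (Pred; _⊆_)
open import Relation.Binary using (tri<; tri≈; tri>)
open import Relation.Binary.Structures using (IsStrictTotalOrder)
open import Relation.Binary.PropositionalEquality
  using (_≡_; _≢_; refl; sym; subst)
open import Level using (0ℓ)

module OrderedFieldProperties (R : CompleteOrderedField) where
  open CompleteOrderedField R
  open IsStrictTotalOrder isStrictTotalOrder using (compare; _≟_) renaming (trans to <-trans)

  ≤-trans : ∀ {a b c} → a ≤ b → b ≤ c → a ≤ c
  ≤-trans (inj₁ a<b) (inj₁ b<c) = inj₁ (<-trans a<b b<c)
  ≤-trans (inj₁ a<b) (inj₂ refl) = inj₁ a<b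
  ≤-trans (inj₂ refl) b≤c       = b≤c

  ≤∧≢⇒< : ∀ {a b} → a ≤ b → a ≢ b → a < b
  ≤∧≢⇒< (inj₁ a<b) _   = a<b
  ≤∧≢⇒< (inj₂ a≡b) a≢b = contradiction a≡b a≢b

  infixl 6 _⊔_

  _⊔_ : ℝ → ℝ → ℝ
  a ⊔ b with compare a b
  ... | tri< _ _ _ = b
  ... | tri≈ _ _ _ = a
  ... | tri> _ _ _ = a

  m≤m⊔n : ∀ a b → a ≤ a ⊔ b
  m≤m⊔n a b with compare a b
  ... | tri< a<b _ _ = inj₁ a<b
  ... | tri≈ _ _ _   = inj₂ refl
  ... | tri> _ _ _   = inj₂ refl

  n≤m⊔n : ∀ a b → b ≤ a ⊔ b
  n≤m⊔n a b with compare a b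
  ... | tri< _ _ _   = inj₂ refl
  ... | tri≈ _ a≡b _ = inj₂ (sym a≡b)
  ... | tri> _ _ b<a = inj₁ b<a

  ⊔-sel : ∀ a b → a ⊔ b ≡ a ⊎ a ⊔ b ≡ b
  ⊔-sel a b with compare a b
  ... | tri< _ _ _ = inj₂ refl
  ... | tri≈ _ _ _ = inj₁ refl
  ... | tri> _ _ _ = inj₁ refl

  IsLub-⊔ : ∀ {P : Pred ℝ 0ℓ} a b → (∀ r → P r → r ≡ a ⊎ r ≡ b) → P a → P b →
            IsLub P (a ⊔ b)
  IsLub-⊔ {P} a b P⊆ab Pa Pb = upper , least
    where
    upper : ∀ r → P r → r ≤ a ⊔ b
    upper r Pr with P⊆ab r Pr
    ... | inj₁ refl = m≤m⊔n a b
    ... | inj₂ refl = n≤m⊔n a b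

    least : ∀ u → (∀ r → P r → r ≤ u) → a ⊔ b ≤ u
    least u ub with ⊔-sel a b
    ... | inj₁ eq = subst (_≤ u) (sym eq) (ub a Pa)
    ... | inj₂ eq = subst (_≤ u) (sym eq) (ub b Pb)

  all<⊎any≡ : ∀ {n} {z s : Fin n → ℝ} → (∀ i → z i ≤ s i) →
              (∀ i → z i < s i) ⊎ ∃ λ j → z j ≡ s j
  all<⊎any≡ {z = z} {s} z≤s with any? (λ j → z j ≟ s j)
  ... | yes touch = inj₂ touch
  ... | no ¬touch = inj₁ λ i → ≤∧≢⇒< (z≤s i) (λ eq → ¬touch (i , eq))

module GeometryProperties (R : CompleteOrderedField) where
  open CompleteOrderedField R
  open Geometry R
  open OrderedFieldProperties R

  module _ {n : ℕ} where

    infixl 21 _⊔ᵥ_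

    _⊔ᵥ_ : Point n → Point n → Point n
    x ⊔ᵥ y = tabulate λ i → π i x ⊔ π i y

    π-⊔ᵥ : ∀ x y i → π i (x ⊔ᵥ y) ≡ π i x ⊔ π i y
    π-⊔ᵥ x y = lookup∘tabulate _

    x≤ᵥx⊔ᵥy : ∀ x y → x ≤ᵥ x ⊔ᵥ y
    x≤ᵥx⊔ᵥy x y i = subst (π i x ≤_) (sym (π-⊔ᵥ x y i)) (m≤m⊔n _ _)

    y≤ᵥx⊔ᵥy : ∀ x y → y ≤ᵥ x ⊔ᵥ y
    y≤ᵥx⊔ᵥy x y i = subst (π i y ≤_) (sym (π-⊔ᵥ x y i)) (n≤m⊔n _ _)

    ⊔ᵥ-sel : ∀ x y i → π i (x ⊔ᵥ y) ≡ π i x ⊎ π i (x ⊔ᵥ y) ≡ π i y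
    ⊔ᵥ-sel x y i rewrite π-⊔ᵥ x y i = ⊔-sel _ _

    IsSup-pair : ∀ x y → IsSup (pair x y) (x ⊔ᵥ y)
    IsSup-pair x y i = subst (IsLub _) (sym (π-⊔ᵥ x y i))
      (IsLub-⊔ _ _ coordinate (x , inj₁ refl , refl) (y , inj₂ refl , refl))
      where
      coordinate : ∀ r → (∃ λ b → pair x y b × π i b ≡ r) → r ≡ π i x ⊎ r ≡ π i y
      coordinate r (b , inj₁ refl , refl) = inj₁ refl
      coordinate r (b , inj₂ refl , refl) = inj₂ refl

    InRect⇒≤ᵥ⊔ᵥ : ∀ x y z → InRect x y z → z ≤ᵥ x ⊔ᵥ y
    InRect⇒≤ᵥ⊔ᵥ x y z rect i with rect i
    ... | inj₁ (_ , zᵢ≤yᵢ) = ≤-trans zᵢ≤yᵢ (y≤ᵥx⊔ᵥy x y i)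
    ... | inj₂ (_ , zᵢ≤xᵢ) = ≤-trans zᵢ≤xᵢ (x≤ᵥx⊔ᵥy x y i)

    pair⊆ : ∀ {A : Pred (Point n) 0ℓ} {x y} → A x → A y → pair x y ⊆ A
    pair⊆ Ax Ay (inj₁ refl) = Ax
    pair⊆ Ax Ay (inj₂ refl) = Ay

    Neighborly⇒touches-face : ∀ {A B : Pred (Point n) 0ℓ} → Neighborly A B →
      ∀ s → IsSup B s → ∀ z → A z → z ≤ᵥ s → ∃ λ j → π j z ≡ π j s
    Neighborly⇒touches-face (_ , _ , noneBelow) s sup z Az z≤s
      with all<⊎any≡ z≤s
    ... | inj₁ z≪s  = contradiction (z , Az , z≪s) (noneBelow s sup)
    ... | inj₂ touch = touch

    InFace-⁅⁆ : ∀ (s w : Point n) j → w ≤ᵥ s → π j w ≡ π j s → InFace s ⁅ j ⁆ w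
    InFace-⁅⁆ s w j w≤s wⱼ≡sⱼ =
      w≤s , λ k k∈⁅j⁆ → subst (λ k → π k w ≡ π k s) (sym (x∈⁅y⁆⇒x≡y j k∈⁅j⁆)) wⱼ≡sⱼ

    Generic⇒face-injective : ∀ {A B : Pred (Point n) 0ℓ} → Generic A →
      B ⊆ A → Neighborly A B → ∀ s → IsSup B s → ∀ j a a' → A a → A a' →
      a ≤ᵥ s → a' ≤ᵥ s → π j a ≡ π j s → π j a' ≡ π j s → a ≡ a'
    Generic⇒face-injective {B = B} gen B⊆A nb s sup j a a' Aa Aa' a≤s a'≤s aⱼ≡sⱼ a'ⱼ≡sⱼ =
      gen B B⊆A nb ⁅ j ⁆ (j , x∈⁅x⁆ j) s sup a a' Aa Aa'
        (InFace-⁅⁆ s a j a≤s aⱼ≡sⱼ) (InFace-⁅⁆ s a' j a'≤s a'ⱼ≡sⱼ)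

    Generic⇒InRect-pair : ∀ {A : Pred (Point n) 0ℓ} → Generic A →
      ∀ x y → A x → A y → Neighborly A (pair x y) →
      ∀ z → A z → InRect x y z → z ≡ x ⊎ z ≡ y
    Generic⇒InRect-pair {A} gen x y Ax Ay nb z Az rect
      with Neighborly⇒touches-face nb (x ⊔ᵥ y) (IsSup-pair x y) z Az z≤s
      where
      z≤s : z ≤ᵥ x ⊔ᵥ y
      z≤s = InRect⇒≤ᵥ⊔ᵥ x y z rect
    ... | j , zⱼ≡sⱼ =
      map (equalOnFace x Ax (x≤ᵥx⊔ᵥy x y)) (equalOnFace y Ay (y≤ᵥx⊔ᵥy x y)) (⊔ᵥ-sel x y j)
      where
      equalOnFace : ∀ a → A a → a ≤ᵥ x ⊔ᵥ y → π j (x ⊔ᵥ y) ≡ π j a → z ≡ a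
      equalOnFace a Aa a≤s sⱼ≡aⱼ =
        Generic⇒face-injective gen (pair⊆ Ax Ay) nb (x ⊔ᵥ y) (IsSup-pair x y) j z a Az Aa
          (InRect⇒≤ᵥ⊔ᵥ x y z rect) a≤s zⱼ≡sⱼ (sym sⱼ≡aⱼ)

mainTheorem4 : (R : CompleteOrderedField) → let open Geometry R in
    ∀ (n : ℕ) (A : Point n → Set) → Generic A →
    ∀ (x y : Point n) → A x → A y → x ≢ y →
    Neighborly A (pair x y) → WeakNeighbor A x y
mainTheorem4 R n A gen x y Ax Ay x≢y nb = Ax , x≢y , λ z Az z≢x z≢y rect →
  [ z≢x , z≢y ] (Generic⇒InRect-pair gen x y Ax Ay nb z Az rect)
  where open GeometryProperties R
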